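{- For ${\bf x}=(x_1,\dots,x_n)$, ${\bf a}=(a_1,a_2,\ldots)$ and any integer $m>0$, $$h^{gl}_m({\bf x}|{\bf a})=\sum_{1\le i_1\le i_2\le\cdots\le i_m\le n}(x_{i_1}+a_{i_1})(x_{i_2}+a_{i_2+1})\cdots(x_{i_m}+a_{i_m+m-1}).$$
   Context: $h^{gl}_m({\bf x}|{\bf a})=[t^m]\prod_{i=1}^n\frac{1}{1-tx_i}\prod_{j=1}^{n+m-1}(1+ta_j)$, where $[t^m]F(t)$ denotes the coefficient of $t^m$ in the power series $F(t)$. -}

module Defs where

open import Level using (Level)
open import Data.Nat using (ℕ; zero; suc; _∸_) renaming (_+_ to _+ℕ_)
open import Data.List using (List; []; _∷_; map; foldr; concatMap; upTo)
open import Algebra.Bundles using (CommutativeRing)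

range : ℕ → ℕ → List ℕ
range lo hi = map (lo +ℕ_) (upTo (suc hi ∸ lo))

weaklyIncr : ℕ → ℕ → ℕ → List (List ℕ)
weaklyIncr zero    lo hi = [] ∷ []
weaklyIncr (suc m) lo hi =
  concatMap (λ i → map (i ∷_) (weaklyIncr m i hi)) (range lo hi)

module _ {c ℓ : Level} (R : CommutativeRing c ℓ) where
  open CommutativeRing R renaming (_+_ to _+R_)

  Σl : List Carrier → Carrier
  Σl = foldr _+R_ 0#

  Πl : List Carrier → Carrier
  Πl = foldr _*_ 1#

  -- formal power series in t over R, as coefficient sequences
  PS : Set c
  PS = ℕ → Carrier

  onePS : PS
  onePS zero    = 1#
  onePS (suc _) = 0#

  _⊛_ : PS → PS → PS
  (f ⊛ g) k = Σl (map (λ i → f i * g (k ∸ i)) (upTo (suc k)))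

  ΠPS : List PS → PS
  ΠPS = foldr _⊛_ onePS

  -- 1/(1 - t y) = Σ_k y^k t^k
  geomPS : Carrier → PS
  geomPS y zero    = 1#
  geomPS y (suc k) = y * geomPS y k

  -- 1 + t y
  linPS : Carrier → PS
  linPS y zero          = 1#
  linPS y (suc zero)    = y
  linPS y (suc (suc _)) = 0#

  -- h^{gl}_m(x|a) = [t^m] ∏_{i=1}^{n} 1/(1 - t x_i) ∏_{j=1}^{n+m-1} (1 + t a_j)
  -- sequences are 1-indexed: x i for 1 ≤ i ≤ n, a j for j ≥ 1 (x 0, a 0 unused)
  hgl : (n m : ℕ) → (x a : ℕ → Carrier) → Carrier
  hgl n m x a =
    (ΠPS (map (λ i → geomPS (x i)) (range 1 n))
      ⊛ ΠPS (map (λ j → linPS (a j)) (range 1 (n +ℕ m ∸ 1)))) m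

  termProd : ℕ → List ℕ → (x a : ℕ → Carrier) → Carrier
  termProd k []       x a = 1#
  termProd k (i ∷ is) x a = (x i +R a (i +ℕ k)) * termProd (suc k) is x a

  rhsSum : (n m : ℕ) → (x a : ℕ → Carrier) → Carrier
  rhsSum n m x a = Σl (map (λ s → termProd 0 s x a) (weaklyIncr m 1 n))

-- Both sides satisfy hₙ,₀ = 1, h₀,ₘ₊₁ = 0 and the recursion
--   hₙ₊₁,ₘ₊₁(x|a) = hₙ,ₘ₊₁(x′|a′) + (x₁ + a₁) hₙ₊₁,ₘ(x|a′),
-- where x′, a′ drop the first entry. For the sum this is the split on whether i₁ = 1.
-- For the generating function, pull the factors 1/(1 - tx₁) and 1 + ta₁ out of the product:
-- (1 + ta₁)/(1 - tx₁) = 1 + t(x₁ + a₁)/(1 - tx₁) splits the coefficient of t^(m+1) into those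
-- of the two generating functions on the right, each left with exactly the n + m factors
-- 1 + taⱼ that its own definition requires.
module Submission where

open import Defs hiding (_⊛_)
open import Level using (Level)
open import Data.Nat using (ℕ; zero; suc; pred; _∸_; _<_; s≤s) renaming (_+_ to _+ℕ_)
open import Data.Nat.Properties
  using (+-suc; n∸n≡0; pred[m∸n]≡m∸[1+n]; +-∸-assoc; suc-injective; n<1+n; m<n⇒m<1+n)
  renaming (+-identityʳ to +ℕ-identityʳ)
open import Data.Fin using (toℕ; inject₁; fromℕ)
open import Data.Fin.Properties using (toℕ-inject₁; toℕ-fromℕ; toℕ≤pred[n])
open import Data.Vec.Functional using (Vector; init; last)
open import Data.List using (List; []; _∷_; map; concatMap; upTo; applyUpTo; _++_)
open import Data.List.Properties using (map-∘; map-upTo; map-cong; map-++)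
open import Function using (_∘_; id)
open import Relation.Binary.PropositionalEquality as ≡ using (_≡_; _≗_; cong; cong₂)
open import Algebra.Bundles using (CommutativeRing)

m∸n≡1+d⇒m∸1+n≡d : ∀ m n {d} → m ∸ n ≡ suc d → m ∸ suc n ≡ d
m∸n≡1+d⇒m∸1+n≡d m n eq = ≡.trans (≡.sym (pred[m∸n]≡m∸[1+n] m n)) (cong pred eq)

range-empty : ∀ lo hi → suc hi ∸ lo ≡ 0 → range lo hi ≡ []
range-empty lo hi eq = cong (map (lo +ℕ_) ∘ upTo) eq

range-cons : ∀ lo hi {d} → suc hi ∸ lo ≡ suc d → range lo hi ≡ lo ∷ range (suc lo) hi
range-cons lo hi {d} eq = begin
    range lo hi
  ≡⟨ cong (map (lo +ℕ_) ∘ upTo) eq ⟩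
    lo +ℕ 0 ∷ map (lo +ℕ_) (applyUpTo suc d)
  ≡⟨ cong₂ _∷_ (+ℕ-identityʳ lo) tail-shift ⟩
    lo ∷ map (suc lo +ℕ_) (upTo d)
  ≡⟨ cong (λ e → lo ∷ map (suc lo +ℕ_) (upTo e)) (≡.sym (m∸n≡1+d⇒m∸1+n≡d (suc hi) lo eq)) ⟩
    lo ∷ range (suc lo) hi
  ∎
  where
  open ≡.≡-Reasoning
  tail-shift : map (lo +ℕ_) (applyUpTo suc d) ≡ map (suc lo +ℕ_) (upTo d)
  tail-shift = ≡.trans (cong (map (lo +ℕ_)) (≡.sym (map-upTo suc d)))
                 (≡.trans (≡.sym (map-∘ (upTo d))) (map-cong (+-suc lo) (upTo d)))

map-range-1 : ∀ {b} {B : Set b} (f : ℕ → B) n → map f (range 1 n) ≡ applyUpTo (f ∘ suc) n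
map-range-1 f n = ≡.trans (≡.sym (map-∘ (upTo n))) (map-upTo (f ∘ suc) n)

weaklyIncr-empty : ∀ m lo hi → suc hi ∸ lo ≡ 0 → weaklyIncr (suc m) lo hi ≡ []
weaklyIncr-empty m lo hi eq =
  cong (concatMap λ i → map (i ∷_) (weaklyIncr m i hi)) (range-empty lo hi eq)

weaklyIncr-cons : ∀ m lo hi {d} → suc hi ∸ lo ≡ suc d →
  weaklyIncr (suc m) lo hi ≡ map (lo ∷_) (weaklyIncr m lo hi) ++ weaklyIncr (suc m) (suc lo) hi
weaklyIncr-cons m lo hi eq =
  cong (concatMap λ i → map (i ∷_) (weaklyIncr m i hi)) (range-cons lo hi eq)

module _ {r ℓ : Level} (R : CommutativeRing r ℓ) where
  open CommutativeRing R hiding (zero)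
  open import Algebra.Properties.CommutativeSemigroup *-commutativeSemigroup using (x∙yz≈y∙xz)
  open import Algebra.Properties.Semiring.Sum semiring
    using (sum; sum-syntax; sum-cong-≋; ∑-distrib-+; *-distribˡ-sum; sum-init-last; sum-replicate-zero)
  open import Relation.Binary.Reasoning.Setoid setoid

  infixl 7 _⊛_
  infixl 6 _⊕_
  infixr 7 _·_
  infix 4 _≐_

  _⊛_ : PS R → PS R → PS R
  _⊛_ = Defs._⊛_ R

  _≐_ : PS R → PS R → Set ℓ
  F ≐ G = ∀ k → F k ≈ G k

  _⊕_ : PS R → PS R → PS R
  (F ⊕ G) k = F k + G k

  _·_ : Carrier → PS R → PS R
  (c · F) k = c * F k

  shift : PS R → PS R
  shift F zero    = 0#
  shift F (suc k) = F k

  shift-cong : ∀ {F G} → F ≐ G → shift F ≐ shift G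
  shift-cong e zero    = refl
  shift-cong e (suc k) = e k

  sum-≈0 : ∀ {n} (f : Vector Carrier n) → (∀ i → f i ≈ 0#) → sum f ≈ 0#
  sum-≈0 {n} f f≈0 = trans (sum-cong-≋ f≈0) (sum-replicate-zero n)

  Σl-map-applyUpTo : ∀ (f : ℕ → Carrier) g n →
    Σl R (map f (applyUpTo g n)) ≡ ∑[ i < n ] f (g (toℕ i))
  Σl-map-applyUpTo f g zero    = ≡.refl
  Σl-map-applyUpTo f g (suc n) = cong (f (g 0) +_) (Σl-map-applyUpTo f (g ∘ suc) n)

  ⊛-terms : PS R → PS R → (k : ℕ) → Vector Carrier (suc k)
  ⊛-terms F G k i = F (toℕ i) * G (k ∸ toℕ i)

  ⊛-coeff : ∀ F G k → (F ⊛ G) k ≡ sum (⊛-terms F G k)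
  ⊛-coeff F G k = Σl-map-applyUpTo (λ i → F i * G (k ∸ i)) id (suc k)

  ⊛-cong : ∀ {F F′ G G′} → F ≐ F′ → G ≐ G′ → F ⊛ G ≐ F′ ⊛ G′
  ⊛-cong {F} {F′} {G} {G′} F≐F′ G≐G′ k = begin
      (F ⊛ G) k
    ≡⟨ ⊛-coeff F G k ⟩
      sum (⊛-terms F G k)
    ≈⟨ sum-cong-≋ {x = ⊛-terms F G k} (λ i → *-cong (F≐F′ (toℕ i)) (G≐G′ (k ∸ toℕ i))) ⟩
      sum (⊛-terms F′ G′ k)
    ≡⟨ ≡.sym (⊛-coeff F′ G′ k) ⟩
      (F′ ⊛ G′) k ∎

  ⊛-congˡ : ∀ {F F′} G → F ≐ F′ → F ⊛ G ≐ F′ ⊛ G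
  ⊛-congˡ G F≐F′ = ⊛-cong {G = G} {G′ = G} F≐F′ (λ _ → refl)

  ⊛-congʳ : ∀ F {G G′} → G ≐ G′ → F ⊛ G ≐ F ⊛ G′
  ⊛-congʳ F G≐G′ = ⊛-cong {F = F} {F′ = F} (λ _ → refl) G≐G′

  ⊛-linearˡ : ∀ F F′ c G → (F ⊕ c · F′) ⊛ G ≐ F ⊛ G ⊕ c · (F′ ⊛ G)
  ⊛-linearˡ F F′ c G k = begin
      ((F ⊕ c · F′) ⊛ G) k
    ≡⟨ ⊛-coeff (F ⊕ c · F′) G k ⟩
      sum (⊛-terms (F ⊕ c · F′) G k)
    ≈⟨ sum-cong-≋ {x = ⊛-terms (F ⊕ c · F′) G k} (λ i →
        trans (distribʳ (G (k ∸ toℕ i)) (F (toℕ i)) (c * F′ (toℕ i)))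
              (+-congˡ (*-assoc c (F′ (toℕ i)) (G (k ∸ toℕ i))))) ⟩
      ∑[ i < suc k ] (⊛-terms F G k i + c * ⊛-terms F′ G k i)
    ≈⟨ ∑-distrib-+ (⊛-terms F G k) (λ i → c * ⊛-terms F′ G k i) ⟩
      sum (⊛-terms F G k) + ∑[ i < suc k ] (c * ⊛-terms F′ G k i)
    ≈⟨ +-congˡ (sym (*-distribˡ-sum c (⊛-terms F′ G k))) ⟩
      sum (⊛-terms F G k) + c * sum (⊛-terms F′ G k)
    ≡⟨ ≡.sym (cong₂ (λ u v → u + c * v) (⊛-coeff F G k) (⊛-coeff F′ G k)) ⟩
      (F ⊛ G) k + c * (F′ ⊛ G) k ∎

  ⊛-linearʳ : ∀ F G G′ c → F ⊛ (G ⊕ c · G′) ≐ F ⊛ G ⊕ c · (F ⊛ G′)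
  ⊛-linearʳ F G G′ c k = begin
      (F ⊛ (G ⊕ c · G′)) k
    ≡⟨ ⊛-coeff F (G ⊕ c · G′) k ⟩
      sum (⊛-terms F (G ⊕ c · G′) k)
    ≈⟨ sum-cong-≋ {x = ⊛-terms F (G ⊕ c · G′) k} (λ i →
        trans (distribˡ (F (toℕ i)) (G (k ∸ toℕ i)) (c * G′ (k ∸ toℕ i)))
              (+-congˡ (x∙yz≈y∙xz (F (toℕ i)) c (G′ (k ∸ toℕ i))))) ⟩
      ∑[ i < suc k ] (⊛-terms F G k i + c * ⊛-terms F G′ k i)
    ≈⟨ ∑-distrib-+ (⊛-terms F G k) (λ i → c * ⊛-terms F G′ k i) ⟩
      sum (⊛-terms F G k) + ∑[ i < suc k ] (c * ⊛-terms F G′ k i)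
    ≈⟨ +-congˡ (sym (*-distribˡ-sum c (⊛-terms F G′ k))) ⟩
      sum (⊛-terms F G k) + c * sum (⊛-terms F G′ k)
    ≡⟨ ≡.sym (cong₂ (λ u v → u + c * v) (⊛-coeff F G k) (⊛-coeff F G′ k)) ⟩
      (F ⊛ G) k + c * (F ⊛ G′) k ∎

  onePS-⊛ : ∀ G → onePS R ⊛ G ≐ G
  onePS-⊛ G k = begin
      (onePS R ⊛ G) k
    ≡⟨ ⊛-coeff (onePS R) G k ⟩
      1# * G k + ∑[ i < k ] (0# * G (k ∸ suc (toℕ i)))
    ≈⟨ +-cong (*-identityˡ _) (sum-≈0 {k} (λ i → 0# * G (k ∸ suc (toℕ i))) (λ _ → zeroˡ _)) ⟩
      G k + 0#
    ≈⟨ +-identityʳ _ ⟩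
      G k ∎

  shift-⊛ : ∀ F G → shift F ⊛ G ≐ shift (F ⊛ G)
  shift-⊛ F G zero    = trans (+-identityʳ _) (zeroˡ _)
  shift-⊛ F G (suc k) = begin
      (shift F ⊛ G) (suc k)
    ≡⟨ ⊛-coeff (shift F) G (suc k) ⟩
      0# * G (suc k) + sum (⊛-terms F G k)
    ≈⟨ trans (+-congʳ (zeroˡ _)) (+-identityˡ _) ⟩
      sum (⊛-terms F G k)
    ≡⟨ ≡.sym (⊛-coeff F G k) ⟩
      (F ⊛ G) k ∎

  ⊛-shift : ∀ F G → F ⊛ shift G ≐ shift (F ⊛ G)
  ⊛-shift F G zero    = trans (+-identityʳ _) (zeroʳ _)
  ⊛-shift F G (suc k) = begin
      (F ⊛ shift G) (suc k)
    ≡⟨ ⊛-coeff F (shift G) (suc k) ⟩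
      sum (⊛-terms F (shift G) (suc k))
    ≈⟨ sum-init-last (⊛-terms F (shift G) (suc k)) ⟩
      sum (init (⊛-terms F (shift G) (suc k))) + last (⊛-terms F (shift G) (suc k))
    ≈⟨ +-cong (sum-cong-≋ init-terms) last-term ⟩
      sum (⊛-terms F G k) + 0#
    ≈⟨ +-identityʳ _ ⟩
      sum (⊛-terms F G k)
    ≡⟨ ≡.sym (⊛-coeff F G k) ⟩
      (F ⊛ G) k ∎
    where
    init-terms : ∀ i → init (⊛-terms F (shift G) (suc k)) i ≈ ⊛-terms F G k i
    init-terms i = reflexive (cong₂ (λ j l → F j * shift G l) (toℕ-inject₁ i)
      (≡.trans (cong (suc k ∸_) (toℕ-inject₁ i)) (+-∸-assoc 1 (toℕ≤pred[n] i))))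
    last-term : last (⊛-terms F (shift G) (suc k)) ≈ 0#
    last-term = trans (*-congˡ (reflexive (cong (shift G)
      (≡.trans (cong (suc k ∸_) (toℕ-fromℕ (suc k))) (n∸n≡0 k))))) (zeroʳ _)

  one⊕·shift-⊛ : ∀ c P G → (onePS R ⊕ c · shift P) ⊛ G ≐ G ⊕ c · shift (P ⊛ G)
  one⊕·shift-⊛ c P G k =
    trans (⊛-linearˡ (onePS R) (shift P) c G k) (+-cong (onePS-⊛ G k) (*-congˡ (shift-⊛ P G k)))

  geomPS-unfold : ∀ x → geomPS R x ≐ onePS R ⊕ x · shift (geomPS R x)
  geomPS-unfold x zero    = sym (trans (+-congˡ (zeroʳ x)) (+-identityʳ 1#))
  geomPS-unfold x (suc k) = sym (+-identityˡ _)

  linPS-unfold : ∀ a → linPS R a ≐ onePS R ⊕ a · shift (onePS R)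
  linPS-unfold a zero          = sym (trans (+-congˡ (zeroʳ a)) (+-identityʳ 1#))
  linPS-unfold a (suc zero)    = sym (trans (+-identityˡ _) (*-identityʳ a))
  linPS-unfold a (suc (suc k)) = sym (trans (+-identityˡ _) (zeroʳ a))

  geomPS-⊛ : ∀ x F → geomPS R x ⊛ F ≐ F ⊕ x · shift (geomPS R x ⊛ F)
  geomPS-⊛ x F k = trans (⊛-congˡ F (geomPS-unfold x) k) (one⊕·shift-⊛ x (geomPS R x) F k)

  linPS-⊛ : ∀ a G → linPS R a ⊛ G ≐ G ⊕ a · shift G
  linPS-⊛ a G k = begin
      (linPS R a ⊛ G) k
    ≈⟨ ⊛-congˡ G (linPS-unfold a) k ⟩
      ((onePS R ⊕ a · shift (onePS R)) ⊛ G) k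
    ≈⟨ one⊕·shift-⊛ a (onePS R) G k ⟩
      G k + a * shift (onePS R ⊛ G) k
    ≈⟨ +-congˡ (*-congˡ (shift-cong (onePS-⊛ G) k)) ⟩
      G k + a * shift G k ∎

  -- the series form of (1 + ta)/(1 - tx) = 1 + t(x + a)/(1 - tx)
  geomPS⊛-linPS⊛ : ∀ x a F G →
    (geomPS R x ⊛ F) ⊛ (linPS R a ⊛ G) ≐ F ⊛ G ⊕ (x + a) · shift ((geomPS R x ⊛ F) ⊛ G)
  geomPS⊛-linPS⊛ x a F G k = begin
      (A ⊛ (linPS R a ⊛ G)) k
    ≈⟨ ⊛-congʳ A (linPS-⊛ a G) k ⟩
      (A ⊛ (G ⊕ a · shift G)) k
    ≈⟨ ⊛-linearʳ A G (shift G) a k ⟩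
      (A ⊛ G) k + a * (A ⊛ shift G) k
    ≈⟨ +-cong (⊛-congˡ G (geomPS-⊛ x F) k) (*-congˡ (⊛-shift A G k)) ⟩
      ((F ⊕ x · shift A) ⊛ G) k + a * shift (A ⊛ G) k
    ≈⟨ +-congʳ (⊛-linearˡ F (shift A) x G k) ⟩
      ((F ⊛ G) k + x * (shift A ⊛ G) k) + a * shift (A ⊛ G) k
    ≈⟨ +-congʳ (+-congˡ (*-congˡ (shift-⊛ A G k))) ⟩
      ((F ⊛ G) k + x * shift (A ⊛ G) k) + a * shift (A ⊛ G) k
    ≈⟨ +-assoc _ _ _ ⟩
      (F ⊛ G) k + (x * shift (A ⊛ G) k + a * shift (A ⊛ G) k)
    ≈⟨ +-congˡ (sym (distribʳ _ x a)) ⟩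
      (F ⊛ G) k + (x + a) * shift (A ⊛ G) k ∎
    where
    A : PS R
    A = geomPS R x ⊛ F

  geomProd : ℕ → (ℕ → Carrier) → PS R
  geomProd n X = ΠPS R (applyUpTo (geomPS R ∘ X) n)

  linProd : ℕ → (ℕ → Carrier) → PS R
  linProd j A = ΠPS R (applyUpTo (linPS R ∘ A) j)

  ⊛-constant-one : ∀ F G → F 0 ≈ 1# → G 0 ≈ 1# → (F ⊛ G) 0 ≈ 1#
  ⊛-constant-one F G F₀≈1 G₀≈1 = trans (+-identityʳ _) (trans (*-cong F₀≈1 G₀≈1) (*-identityˡ 1#))

  ΠPS-constant-one : ∀ (F : ℕ → PS R) n → (∀ i → F i 0 ≈ 1#) → ΠPS R (applyUpTo F n) 0 ≈ 1#
  ΠPS-constant-one F zero    F₀≈1 = refl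
  ΠPS-constant-one F (suc n) F₀≈1 = ⊛-constant-one (F 0) (ΠPS R (applyUpTo (F ∘ suc) n))
    (F₀≈1 0) (ΠPS-constant-one (F ∘ suc) n (F₀≈1 ∘ suc))

  linProd-vanishes : ∀ j A k → j < k → linProd j A k ≈ 0#
  linProd-vanishes zero    A (suc k) _         = refl
  linProd-vanishes (suc j) A (suc k) (s≤s j<k) = begin
      linProd (suc j) A (suc k)
    ≈⟨ linPS-⊛ (A 0) (linProd j (A ∘ suc)) (suc k) ⟩
      linProd j (A ∘ suc) (suc k) + A 0 * linProd j (A ∘ suc) k
    ≈⟨ +-cong (linProd-vanishes j (A ∘ suc) (suc k) (m<n⇒m<1+n j<k))
              (*-congˡ (linProd-vanishes j (A ∘ suc) k j<k)) ⟩
      0# + A 0 * 0#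
    ≈⟨ trans (+-identityˡ _) (zeroʳ _) ⟩
      0# ∎

  -- hₙ,ₘ(x|a) of the header, for the 0-indexed sequences X i = xᵢ₊₁, A j = aⱼ₊₁
  hglRec : ℕ → ℕ → (ℕ → Carrier) → (ℕ → Carrier) → Carrier
  hglRec n       zero    X A = 1#
  hglRec zero    (suc m) X A = 0#
  hglRec (suc n) (suc m) X A =
    hglRec n (suc m) (X ∘ suc) (A ∘ suc) + (X 0 + A 0) * hglRec (suc n) m X (A ∘ suc)

  hglRec-cong : ∀ n m {X X′ A A′} → X ≗ X′ → A ≗ A′ → hglRec n m X A ≈ hglRec n m X′ A′
  hglRec-cong n       zero    X≗X′ A≗A′ = refl
  hglRec-cong zero    (suc m) X≗X′ A≗A′ = refl
  hglRec-cong (suc n) (suc m) X≗X′ A≗A′ =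
    +-cong (hglRec-cong n (suc m) (X≗X′ ∘ suc) (A≗A′ ∘ suc))
           (*-cong (+-cong (reflexive (X≗X′ 0)) (reflexive (A≗A′ 0)))
                   (hglRec-cong (suc n) m X≗X′ (A≗A′ ∘ suc)))

  geomProd⊛linProd : ∀ n m j X A → j ≡ n +ℕ m ∸ 1 →
    (geomProd n X ⊛ linProd j A) m ≈ hglRec n m X A
  geomProd⊛linProd n zero j X A _ =
    ⊛-constant-one (geomProd n X) (linProd j A)
      (ΠPS-constant-one (geomPS R ∘ X) n (λ _ → refl)) (ΠPS-constant-one (linPS R ∘ A) j (λ _ → refl))
  geomProd⊛linProd zero (suc m) .m X A ≡.refl =
    trans (onePS-⊛ (linProd m A) (suc m)) (linProd-vanishes m A (suc m) (n<1+n m))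
  geomProd⊛linProd (suc n) (suc m) zero X A eq with ≡.trans eq (+-suc n m)
  ... | ()
  geomProd⊛linProd (suc n) (suc m) (suc j) X A eq = begin
      (geomProd (suc n) X ⊛ linProd (suc j) A) (suc m)
    ≈⟨ geomPS⊛-linPS⊛ (X 0) (A 0) (geomProd n (X ∘ suc)) (linProd j (A ∘ suc)) (suc m) ⟩
      (geomProd n (X ∘ suc) ⊛ linProd j (A ∘ suc)) (suc m)
        + (X 0 + A 0) * (geomProd (suc n) X ⊛ linProd j (A ∘ suc)) m
    ≈⟨ +-cong (geomProd⊛linProd n (suc m) j (X ∘ suc) (A ∘ suc)
                 (≡.trans j≡n+m (cong (_∸ 1) (≡.sym (+-suc n m)))))
              (*-congˡ (geomProd⊛linProd (suc n) m j X (A ∘ suc) j≡n+m)) ⟩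
      hglRec (suc n) (suc m) X A ∎
    where
    j≡n+m : j ≡ n +ℕ m
    j≡n+m = suc-injective (≡.trans eq (+-suc n m))

  hgl≈hglRec : ∀ n m x a → hgl R n m x a ≈ hglRec n m (x ∘ suc) (a ∘ suc)
  hgl≈hglRec n m x a = trans
    (reflexive (cong₂ (λ Fs Gs → (ΠPS R Fs ⊛ ΠPS R Gs) m)
      (map-range-1 (geomPS R ∘ x) n) (map-range-1 (linPS R ∘ a) (n +ℕ m ∸ 1))))
    (geomProd⊛linProd n m (n +ℕ m ∸ 1) (x ∘ suc) (a ∘ suc) ≡.refl)

  Σl-++ : ∀ xs ys → Σl R (xs ++ ys) ≈ Σl R xs + Σl R ys
  Σl-++ []       ys = sym (+-identityˡ _)
  Σl-++ (z ∷ xs) ys = trans (+-congˡ (Σl-++ xs ys)) (sym (+-assoc _ _ _))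

  *-distribˡ-Σl : ∀ c xs → c * Σl R xs ≈ Σl R (map (c *_) xs)
  *-distribˡ-Σl c []       = zeroʳ c
  *-distribˡ-Σl c (z ∷ xs) = trans (distribˡ c z _) (+-congˡ (*-distribˡ-Σl c xs))

  module _ (x a : ℕ → Carrier) where

    termSum : ℕ → ℕ → ℕ → ℕ → Carrier
    termSum m lo hi k = Σl R (map (λ s → termProd R k s x a) (weaklyIncr m lo hi))

    termSum-cons : ∀ m lo hi k {d} → suc hi ∸ lo ≡ suc d →
      termSum (suc m) lo hi k
        ≈ (x lo + a (lo +ℕ k)) * termSum m lo hi (suc k) + termSum (suc m) (suc lo) hi k
    termSum-cons m lo hi k eq = begin
        termSum (suc m) lo hi k
      ≡⟨ cong (Σl R ∘ map term) (weaklyIncr-cons m lo hi eq) ⟩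
        Σl R (map term (map (lo ∷_) W ++ W′))
      ≡⟨ cong (Σl R) (map-++ term (map (lo ∷_) W) W′) ⟩
        Σl R (map term (map (lo ∷_) W) ++ map term W′)
      ≈⟨ Σl-++ (map term (map (lo ∷_) W)) (map term W′) ⟩
        Σl R (map term (map (lo ∷_) W)) + termSum (suc m) (suc lo) hi k
      ≡⟨ cong (λ l → Σl R l + termSum (suc m) (suc lo) hi k)
              (≡.trans (≡.sym (map-∘ W)) (map-∘ W)) ⟩
        Σl R (map (c *_) (map (λ s → termProd R (suc k) s x a) W)) + termSum (suc m) (suc lo) hi k
      ≈⟨ +-congʳ (sym (*-distribˡ-Σl c (map (λ s → termProd R (suc k) s x a) W))) ⟩
        c * termSum m lo hi (suc k) + termSum (suc m) (suc lo) hi k ∎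
      where
      term : List ℕ → Carrier
      term s = termProd R k s x a
      c : Carrier
      c = x lo + a (lo +ℕ k)
      W W′ : List (List ℕ)
      W  = weaklyIncr m lo hi
      W′ = weaklyIncr (suc m) (suc lo) hi

    termSum≈hglRec : ∀ d m lo hi k → suc hi ∸ lo ≡ d →
      termSum m lo hi k ≈ hglRec d m (λ i → x (lo +ℕ i)) (λ j → a (lo +ℕ k +ℕ j))
    termSum≈hglRec d       zero    lo hi k _  = +-identityʳ 1#
    termSum≈hglRec zero    (suc m) lo hi k eq =
      reflexive (cong (Σl R ∘ map (λ s → termProd R k s x a)) (weaklyIncr-empty m lo hi eq))
    termSum≈hglRec (suc d) (suc m) lo hi k eq = begin
        termSum (suc m) lo hi k
      ≈⟨ termSum-cons m lo hi k eq ⟩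
        (x lo + a (lo +ℕ k)) * termSum m lo hi (suc k) + termSum (suc m) (suc lo) hi k
      ≈⟨ +-cong (*-cong first-factor fewer-a) fewer-x ⟩
        (X 0 + A 0) * hglRec (suc d) m X (A ∘ suc) + hglRec d (suc m) (X ∘ suc) (A ∘ suc)
      ≈⟨ +-comm _ _ ⟩
        hglRec (suc d) (suc m) X A ∎
      where
      X A : ℕ → Carrier
      X i = x (lo +ℕ i)
      A j = a (lo +ℕ k +ℕ j)
      first-factor : x lo + a (lo +ℕ k) ≈ X 0 + A 0
      first-factor = reflexive (≡.sym (cong₂ _+_ (cong x (+ℕ-identityʳ lo)) (cong a (+ℕ-identityʳ _))))
      fewer-a : termSum m lo hi (suc k) ≈ hglRec (suc d) m X (A ∘ suc)
      fewer-a = trans (termSum≈hglRec (suc d) m lo hi (suc k) eq)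
        (hglRec-cong (suc d) m (λ _ → ≡.refl)
          (λ j → cong a (≡.trans (cong (_+ℕ j) (+-suc lo k)) (≡.sym (+-suc (lo +ℕ k) j)))))
      fewer-x : termSum (suc m) (suc lo) hi k ≈ hglRec d (suc m) (X ∘ suc) (A ∘ suc)
      fewer-x = trans (termSum≈hglRec d (suc m) (suc lo) hi k (m∸n≡1+d⇒m∸1+n≡d (suc hi) lo eq))
        (hglRec-cong d (suc m) (λ i → cong x (≡.sym (+-suc lo i)))
                               (λ j → cong a (≡.sym (+-suc (lo +ℕ k) j))))

  rhsSum≈hglRec : ∀ n m x a → rhsSum R n m x a ≈ hglRec n m (x ∘ suc) (a ∘ suc)
  rhsSum≈hglRec n m x a = termSum≈hglRec x a n m 1 n 0 ≡.refl

lemma3 : {c ℓ : Level} (R : CommutativeRing c ℓ) (n m : ℕ)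
         (x a : ℕ → CommutativeRing.Carrier R) → 0 < m →
         CommutativeRing._≈_ R (hgl R n m x a) (rhsSum R n m x a)
lemma3 R n m x a _ =
  CommutativeRing.trans R (hgl≈hglRec R n m x a) (CommutativeRing.sym R (rhsSum≈hglRec R n m x a))
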